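{- For $n\ge1$, \[(1+q)\operatorname{Cat}^{+\!\!+}(A_n;q)+q\operatorname{Cat}^{+\!\!+}(A_{n-1};q)=q\operatorname{Cat}(A_{n-1};q).\]
   Context: $A_n$ denotes the Coxeter group of type $A_n$ (the symmetric group $S_{n+1}$), $A_0$ the trivial group. For a finite Coxeter group $W$ with simple reflections $S$ and Coxeter element $c$, $\operatorname{Cat}(W;q)=\sum_w q^{\operatorname{des}(w)}$ over $c$-sortable elements $w$ (independent of $c$), where $\operatorname{des}(w)$ is the number of $s\in S$ with $\ell(ws)<\ell(w)$; $c$-sortable: for a reduced word $a_1\cdots a_n$ of $c$, the $c$-sorting word of $w$ is the leftmost subword of $a_1\cdots a_na_1\cdots a_n\cdots$ that is reduced for $w$, and $w$ is $c$-sortable iff the sets $K_i$ of letters used from the successive copies satisfy $K_1\supseteq K_2\supseteq\cdots$. (For type $A_n$, $\operatorname{Cat}(A_n;q)=\sum_k\frac{1}{n+1}\binom{n+1}{k}\binom{n+1}{k+1}q^k$.) With $W_J$ the standard parabolic subgroup generated by $J\subseteq S$: $\operatorname{Cat}^+(W;q)=\sum_{J\subseteq S}(-1)^{|S|-|J|}\operatorname{Cat}(W_J;q)$ and $\operatorname{Cat}^{+\!\!+}(W;q)=\sum_{J\subseteq S}(-q)^{|S|-|J|}\operatorname{Cat}^+(W_J;q)$. -}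

module Defs where

open import Data.Nat as ℕ using (ℕ; zero; suc)
open import Data.Nat.DivMod using (_/_)
open import Data.Nat.Combinatorics using (_C_)
open import Data.Integer as ℤ using (ℤ; +_)
open import Data.Bool using (Bool; true; false; _∧_; not; if_then_else_)
open import Data.List using (List; []; _∷_; _++_; map; foldr)
open import Data.Vec using (Vec; []; _∷_; toList)
open import Relation.Binary.PropositionalEquality using (_≡_)

-- Polynomials in q with integer coefficients, as coefficient functions
-- (coefficient of q^k).  Equality is coefficientwise.

Poly : Set
Poly = ℕ → ℤ

infix  4 _≈ₚ_
infixl 6 _+ₚ_
infixl 7 _*ₚ_

_≈ₚ_ : Poly → Poly → Set
f ≈ₚ g = ∀ k → f k ≡ g k

0ₚ : Poly
0ₚ _ = + 0

1ₚ : Poly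
1ₚ zero    = + 1
1ₚ (suc _) = + 0

qₚ : Poly
qₚ 1 = + 1
qₚ _ = + 0

_+ₚ_ : Poly → Poly → Poly
(f +ₚ g) k = f k ℤ.+ g k

-ₚ_ : Poly → Poly
(-ₚ f) k = ℤ.- f k

sumUpTo : (ℕ → ℤ) → ℕ → ℤ
sumUpTo h zero    = h zero
sumUpTo h (suc k) = sumUpTo h k ℤ.+ h (suc k)

_*ₚ_ : Poly → Poly → Poly
(f *ₚ g) k = sumUpTo (λ i → f i ℤ.* g (k ℕ.∸ i)) k

_^ₚ_ : Poly → ℕ → Poly
f ^ₚ zero  = 1ₚ
f ^ₚ suc m = f *ₚ (f ^ₚ m)

sumₚ : List Poly → Poly
sumₚ = foldr _+ₚ_ 0ₚ

prodₚ : List Poly → Poly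
prodₚ = foldr _*ₚ_ 1ₚ

-- Cat(A_n; q) = Σ_k (1/(n+1)) C(n+1,k) C(n+1,k+1) q^k
-- (the type-A formula stated in the context; the division is exact).

narayana : ℕ → ℕ → ℕ
narayana n k = ((suc n C k) ℕ.* (suc n C suc k)) / suc n

CatA : ℕ → Poly
CatA n k = + narayana n k

-- Subsets J of the simple reflections S = {s_1,…,s_n} of A_n,
-- as boolean vectors (J i = true iff s_{i+1} ∈ J).

Subset : ℕ → Set
Subset n = Vec Bool n

allSubsets : (n : ℕ) → List (Subset n)
allSubsets zero    = [] ∷ []
allSubsets (suc n) = map (false ∷_) (allSubsets n) ++ map (true ∷_) (allSubsets n)

_⊆ᵇ_ : ∀ {n} → Subset n → Subset n → Bool
[]       ⊆ᵇ []       = true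
(k ∷ ks) ⊆ᵇ (j ∷ js) = (if k then j else true) ∧ (ks ⊆ᵇ js)

card : ∀ {n} → Subset n → ℕ
card []          = 0
card (true ∷ j)  = suc (card j)
card (false ∷ j) = card j

subsetsOf : ∀ {n} → Subset n → List (Subset n)
subsetsOf {n} J = Data.List.filterᵇ (λ K → K ⊆ᵇ J) (allSubsets n)
  where import Data.List

-- Lengths of the maximal runs of consecutive generators in J
-- (the connected components of the Coxeter diagram of W_J, a path).
-- Empty runs may appear; they correspond to the trivial factor A_0.
runs : List Bool → List ℕ
runs []            = 0 ∷ []
runs (false ∷ bs)  = 0 ∷ runs bs
runs (true ∷ bs)   with runs bs
... | []     = 1 ∷ []
... | r ∷ rs = suc r ∷ rs

-- Cat(W_J; q) for the standard parabolic subgroup W_J of A_n: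
-- W_J ≅ A_{r_1} × ⋯ × A_{r_m} (r_i the run lengths), and Cat of a
-- product of Coxeter groups is the product of the Cat's.
CatPar : ∀ {n} → Subset n → Poly
CatPar J = prodₚ (map CatA (runs (toList J)))

CatPlusPar : ∀ {n} → Subset n → Poly
CatPlusPar J =
  sumₚ (map (λ K → ((-ₚ 1ₚ) ^ₚ (card J ℕ.∸ card K)) *ₚ CatPar K) (subsetsOf J))

CatPlusPlusA : ℕ → Poly
CatPlusPlusA n =
  sumₚ (map (λ J → ((-ₚ qₚ) ^ₚ (n ℕ.∸ card J)) *ₚ CatPlusPar J) (allSubsets n))

{-# OPTIONS --safe #-}
module Submission where

open import Defs
open import Data.Nat using (ℕ; _≤_; _∸_)

-- Write N(x) = Σₙ Cat(Aₙ;q) xⁿ and G(x) = Σₙ Cat⁺⁺(Aₙ;q) xⁿ, power series over ℤ[q].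
-- Summing the two alternating sums over the intermediate J gives
-- Cat⁺⁺(Aₙ) = Σ_{K⊆S} (-1-q)^{n-|K|} Cat(W_K), and Cat(W_K) is the product of Cat over
-- the runs of consecutive generators in K; cutting at the first generator not in K yields
-- G = N - (1+q) x N G.  The Narayana polynomials satisfy N = 1 + (1+q) x N + q (x N)²:
-- the coefficients of the powers (x N)ᵐ have a closed binomial form that visibly obeys the
-- corresponding lattice-path recurrence.  Eliminating, ((1+q) + q x) G = (1+q) + q x N,
-- whose coefficient of x^{n} for n ≥ 1 is the claim.

open import Level using (0ℓ)
open import Algebra.Bundles using (CommutativeRing; RawRing)
open import Algebra.Morphism.Structures using (IsRingMonomorphism)
open import Algebra.Solver.Ring.AlmostCommutativeRing
  using (_-Raw-AlmostCommutative⟶_; fromCommutativeRing; -raw-almostCommutative⟶)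
open import Data.Bool using (Bool; true; false)
open import Data.Integer as ℤ using (ℤ; +_; -[1+_])
import Data.Integer.Properties as ℤₚ
import Data.Integer.Tactic.RingSolver as ℤ-Solver
open import Data.List using (List; []; _∷_; _++_; map; filterᵇ)
import Data.List.Properties as Listₚ
open import Data.List.Relation.Unary.All as All using (All; []; _∷_)
import Data.List.Relation.Unary.All.Properties as Allₚ
open import Data.Maybe using () renaming (map to mapMaybe)
open import Data.Nat as ℕ using (zero; suc; z≤n; s≤s)
import Data.Nat.Properties as ℕₚ
open import Data.Nat.Combinatorics using (_C_; nC1≡n; nCk+nC[k+1]≡[n+1]C[k+1])
open import Data.Nat.DivMod using (_/_; m*n/n≡m)
import Data.Nat.Tactic.RingSolver as ℕ-Solver
open import Data.Product using (∃₂; _,_)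
open import Data.Vec using ([]; _∷_; replicate; toList)
open import Function using (id; _∘_)
open import Relation.Binary.PropositionalEquality as ≡ using (_≡_)
open import Relation.Nullary using (dec⇒maybe)

module FormalPowerSeries {c ℓ} (R : CommutativeRing c ℓ) where

  open CommutativeRing R hiding (zero)
  open import Algebra.Properties.Ring ring using (-0#≈0#)
  open import Algebra.Properties.CommutativeSemigroup +-commutativeSemigroup using (interchange)
  open import Relation.Binary.Reasoning.Setoid setoid

  Series : Set c
  Series = ℕ → Carrier

  infix  4 _≋_
  infixl 6 _⊕_
  infixl 7 _⊛_
  infix  8 ⊝_

  _≋_ : Series → Series → Set ℓ
  f ≋ g = ∀ k → f k ≈ g k

  _⊕_ : Series → Series → Series
  (f ⊕ g) k = f k + g k

  ⊝_ : Series → Series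
  (⊝ f) k = - f k

  const : Carrier → Series
  const a zero    = a
  const a (suc _) = 0#

  𝟘 : Series
  𝟘 _ = 0#

  𝟙 : Series
  𝟙 = const 1#

  X : Series
  X zero    = 0#
  X (suc k) = 𝟙 k

  sum≤ : (ℕ → Carrier) → ℕ → Carrier
  sum≤ h zero    = h zero
  sum≤ h (suc k) = sum≤ h k + h (suc k)

  _⊛_ : Series → Series → Series
  (f ⊛ g) k = sum≤ (λ i → f i * g (k ∸ i)) k

  sum≤-congᵇ : ∀ {h h′} k → (∀ i → i ≤ k → h i ≈ h′ i) → sum≤ h k ≈ sum≤ h′ k
  sum≤-congᵇ zero    h≈h′ = h≈h′ zero z≤n
  sum≤-congᵇ (suc k) h≈h′ =
    +-cong (sum≤-congᵇ k (λ i i≤k → h≈h′ i (ℕₚ.m≤n⇒m≤1+n i≤k))) (h≈h′ (suc k) ℕₚ.≤-refl)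

  sum≤-cong : ∀ {h h′} k → (∀ i → h i ≈ h′ i) → sum≤ h k ≈ sum≤ h′ k
  sum≤-cong k h≈h′ = sum≤-congᵇ k (λ i _ → h≈h′ i)

  sum≤-+ : ∀ h h′ k → sum≤ (λ i → h i + h′ i) k ≈ sum≤ h k + sum≤ h′ k
  sum≤-+ h h′ zero    = refl
  sum≤-+ h h′ (suc k) = trans (+-congʳ (sum≤-+ h h′ k)) (interchange _ _ _ _)

  sum≤-*ˡ : ∀ a h k → a * sum≤ h k ≈ sum≤ (λ i → a * h i) k
  sum≤-*ˡ a h zero    = refl
  sum≤-*ˡ a h (suc k) = trans (distribˡ _ _ _) (+-congʳ (sum≤-*ˡ a h k))

  sum≤-*ʳ : ∀ a h k → sum≤ h k * a ≈ sum≤ (λ i → h i * a) k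
  sum≤-*ʳ a h zero    = refl
  sum≤-*ʳ a h (suc k) = trans (distribʳ _ _ _) (+-congʳ (sum≤-*ʳ a h k))

  sum≤-0 : ∀ k → sum≤ (λ _ → 0#) k ≈ 0#
  sum≤-0 zero    = refl
  sum≤-0 (suc k) = trans (+-identityʳ _) (sum≤-0 k)

  sum≤-suc : ∀ h k → sum≤ h (suc k) ≈ h zero + sum≤ (λ i → h (suc i)) k
  sum≤-suc h zero    = refl
  sum≤-suc h (suc k) = trans (+-congʳ (sum≤-suc h k)) (+-assoc _ _ _)

  sum≤-reverse : ∀ h k → sum≤ h k ≈ sum≤ (λ i → h (k ∸ i)) k
  sum≤-reverse h zero    = refl
  sum≤-reverse h (suc k) = begin
    sum≤ h k + h (suc k)                  ≈⟨ +-congʳ (sum≤-reverse h k) ⟩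
    sum≤ (λ i → h (k ∸ i)) k + h (suc k)  ≈⟨ +-comm _ _ ⟩
    h (suc k) + sum≤ (λ i → h (k ∸ i)) k  ≈⟨ sum≤-suc (λ i → h (suc k ∸ i)) k ⟨
    sum≤ (λ i → h (suc k ∸ i)) (suc k)    ∎

  sum≤-triangle : ∀ (F : ℕ → ℕ → Carrier) n →
    sum≤ (λ m → sum≤ (λ i → F i m) m) n ≈ sum≤ (λ i → sum≤ (λ j → F i (i ℕ.+ j)) (n ∸ i)) n
  sum≤-triangle F zero    = refl
  sum≤-triangle F (suc n) = begin
    sum≤ (λ m → sum≤ (λ i → F i m) m) n + (sum≤ (λ i → F i (suc n)) n + F (suc n) (suc n))
      ≈⟨ +-congʳ (sum≤-triangle F n) ⟩
    sum≤ rows n + (sum≤ (λ i → F i (suc n)) n + F (suc n) (suc n))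
      ≈⟨ +-assoc _ _ _ ⟨
    sum≤ rows n + sum≤ (λ i → F i (suc n)) n + F (suc n) (suc n)
      ≈⟨ +-congʳ (sum≤-+ rows (λ i → F i (suc n)) n) ⟨
    sum≤ (λ i → rows i + F i (suc n)) n + F (suc n) (suc n)
      ≈⟨ +-cong (sum≤-congᵇ n extendRow) lastRow ⟩
    sum≤ (λ i → sum≤ (λ j → F i (i ℕ.+ j)) (suc n ∸ i)) (suc n) ∎
    where
    rows : ℕ → Carrier
    rows i = sum≤ (λ j → F i (i ℕ.+ j)) (n ∸ i)
    extendRow : ∀ i → i ≤ n → rows i + F i (suc n) ≈ sum≤ (λ j → F i (i ℕ.+ j)) (suc n ∸ i)
    extendRow i i≤n rewrite ℕₚ.+-∸-assoc 1 i≤n | ℕₚ.+-suc i (n ∸ i) | ℕₚ.m+[n∸m]≡n i≤n = refl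
    lastRow : F (suc n) (suc n) ≈ sum≤ (λ j → F (suc n) (suc n ℕ.+ j)) (n ∸ n)
    lastRow rewrite ℕₚ.n∸n≡0 n | ℕₚ.+-identityʳ n = refl

  ⊕-cong : ∀ {f f′ g g′} → f ≋ f′ → g ≋ g′ → f ⊕ g ≋ f′ ⊕ g′
  ⊕-cong f≋f′ g≋g′ k = +-cong (f≋f′ k) (g≋g′ k)

  ⊛-cong : ∀ {f f′ g g′} → f ≋ f′ → g ≋ g′ → f ⊛ g ≋ f′ ⊛ g′
  ⊛-cong f≋f′ g≋g′ k = sum≤-cong k (λ i → *-cong (f≋f′ i) (g≋g′ (k ∸ i)))

  ⊛-comm : ∀ f g → f ⊛ g ≋ g ⊛ f
  ⊛-comm f g k = trans (sum≤-reverse _ k) (sum≤-congᵇ k swap)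
    where
    swap : ∀ i → i ≤ k → f (k ∸ i) * g (k ∸ (k ∸ i)) ≈ g i * f (k ∸ i)
    swap i i≤k rewrite ℕₚ.m∸[m∸n]≡n i≤k = *-comm _ _

  ⊛-assoc : ∀ f g h → (f ⊛ g) ⊛ h ≋ f ⊛ (g ⊛ h)
  ⊛-assoc f g h n = begin
    sum≤ (λ m → sum≤ (λ i → f i * g (m ∸ i)) m * h (n ∸ m)) n
      ≈⟨ sum≤-cong n (λ m → sum≤-*ʳ (h (n ∸ m)) _ m) ⟩
    sum≤ (λ m → sum≤ (λ i → f i * g (m ∸ i) * h (n ∸ m)) m) n
      ≈⟨ sum≤-triangle (λ i m → f i * g (m ∸ i) * h (n ∸ m)) n ⟩
    sum≤ (λ i → sum≤ (λ j → f i * g (i ℕ.+ j ∸ i) * h (n ∸ (i ℕ.+ j))) (n ∸ i)) n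
      ≈⟨ sum≤-cong n (λ i → sum≤-cong (n ∸ i) (reindex i)) ⟩
    sum≤ (λ i → sum≤ (λ j → f i * (g j * h (n ∸ i ∸ j))) (n ∸ i)) n
      ≈⟨ sum≤-cong n (λ i → sum≤-*ˡ (f i) _ (n ∸ i)) ⟨
    sum≤ (λ i → f i * sum≤ (λ j → g j * h (n ∸ i ∸ j)) (n ∸ i)) n ∎
    where
    reindex : ∀ i j → f i * g (i ℕ.+ j ∸ i) * h (n ∸ (i ℕ.+ j)) ≈ f i * (g j * h (n ∸ i ∸ j))
    reindex i j rewrite ℕₚ.m+n∸m≡n i j | ℕₚ.∸-+-assoc n i j = *-assoc _ _ _

  ⊛-distribˡ : ∀ f g h → f ⊛ (g ⊕ h) ≋ f ⊛ g ⊕ f ⊛ h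
  ⊛-distribˡ f g h k = trans (sum≤-cong k (λ i → distribˡ _ _ _)) (sum≤-+ _ _ k)

  ⊛-distribʳ : ∀ f g h → (g ⊕ h) ⊛ f ≋ g ⊛ f ⊕ h ⊛ f
  ⊛-distribʳ f g h k = trans (sum≤-cong k (λ i → distribʳ _ _ _)) (sum≤-+ _ _ k)

  const-⊛ : ∀ a f k → (const a ⊛ f) k ≈ a * f k
  const-⊛ a f zero    = refl
  const-⊛ a f (suc k) = begin
    (const a ⊛ f) (suc k)                         ≈⟨ sum≤-suc _ k ⟩
    a * f (suc k) + sum≤ (λ i → 0# * f (k ∸ i)) k  ≈⟨ +-congˡ (sum≤-cong k (λ i → zeroˡ _)) ⟩
    a * f (suc k) + sum≤ (λ _ → 0#) k              ≈⟨ +-congˡ (sum≤-0 k) ⟩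
    a * f (suc k) + 0#                             ≈⟨ +-identityʳ _ ⟩
    a * f (suc k)                                  ∎

  ⊛-identityˡ : ∀ f → 𝟙 ⊛ f ≋ f
  ⊛-identityˡ f k = trans (const-⊛ 1# f k) (*-identityˡ _)

  commutativeRing : CommutativeRing c ℓ
  commutativeRing = record
    { Carrier = Series ; _≈_ = _≋_ ; _+_ = _⊕_ ; _*_ = _⊛_ ; -_ = ⊝_ ; 0# = 𝟘 ; 1# = 𝟙
    ; isCommutativeRing = record
      { isRing = record
        { +-isAbelianGroup = record
          { isGroup = record
            { isMonoid = record
              { isSemigroup = record
                { isMagma = record
                  { isEquivalence = record
                    { refl = λ _ → refl ; sym = λ f≋g k → sym (f≋g k)
                    ; trans = λ f≋g g≋h k → trans (f≋g k) (g≋h k) }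
                  ; ∙-cong = ⊕-cong }
                ; assoc = λ f g h k → +-assoc (f k) (g k) (h k) }
              ; identity = (λ f k → +-identityˡ (f k)) , (λ f k → +-identityʳ (f k)) }
            ; inverse = (λ f k → -‿inverseˡ (f k)) , (λ f k → -‿inverseʳ (f k))
            ; ⁻¹-cong = λ f≋g k → -‿cong (f≋g k) }
          ; comm = λ f g k → +-comm (f k) (g k) }
        ; *-cong = ⊛-cong
        ; *-assoc = ⊛-assoc
        ; *-identity = ⊛-identityˡ , (λ f k → trans (⊛-comm f 𝟙 k) (⊛-identityˡ f k))
        ; distrib = ⊛-distribˡ , ⊛-distribʳ }
      ; *-comm = ⊛-comm } }

  X⊛-zero : ∀ f → (X ⊛ f) zero ≈ 0#
  X⊛-zero f = zeroˡ _

  X⊛-suc : ∀ f k → (X ⊛ f) (suc k) ≈ f k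
  X⊛-suc f k = begin
    (X ⊛ f) (suc k)                               ≈⟨ sum≤-suc _ k ⟩
    0# * f (suc k) + (const 1# ⊛ f) k              ≈⟨ +-cong (zeroˡ _) (⊛-identityˡ f k) ⟩
    0# + f k                                       ≈⟨ +-identityˡ _ ⟩
    f k                                            ∎

  X⊛-cancel : ∀ {f g} → X ⊛ f ≋ X ⊛ g → f ≋ g
  X⊛-cancel {f} {g} Xf≋Xg k = trans (sym (X⊛-suc f k)) (trans (Xf≋Xg (suc k)) (X⊛-suc g k))

  fixedPoint-X⊛-unique : ∀ {E} H → E ≋ X ⊛ (H ⊛ E) → E ≋ 𝟘
  fixedPoint-X⊛-unique {E} H E≋XHE k = vanishes k k ℕₚ.≤-refl
    where
    vanishes : ∀ n i → i ≤ n → E i ≈ 0#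
    vanishes n       zero    _         = trans (E≋XHE zero) (X⊛-zero (H ⊛ E))
    vanishes (suc n) (suc i) (s≤s i≤n) = begin
      E (suc i)                          ≈⟨ E≋XHE (suc i) ⟩
      (X ⊛ (H ⊛ E)) (suc i)              ≈⟨ X⊛-suc (H ⊛ E) i ⟩
      sum≤ (λ j → H j * E (i ∸ j)) i     ≈⟨ sum≤-congᵇ i term-vanishes ⟩
      sum≤ (λ _ → 0#) i                  ≈⟨ sum≤-0 i ⟩
      0#                                 ∎
      where
      term-vanishes : ∀ j → j ≤ i → H j * E (i ∸ j) ≈ 0#
      term-vanishes j _ = trans (*-congˡ (vanishes n (i ∸ j) (ℕₚ.≤-trans (ℕₚ.m∸n≤m i j) i≤n))) (zeroʳ _)

  const-cong : ∀ {a b} → a ≈ b → const a ≋ const b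
  const-cong a≈b zero    = a≈b
  const-cong a≈b (suc k) = refl

  const-+ : ∀ a b → const (a + b) ≋ const a ⊕ const b
  const-+ a b zero    = refl
  const-+ a b (suc k) = sym (+-identityʳ 0#)

  const-* : ∀ a b → const (a * b) ≋ const a ⊛ const b
  const-* a b zero    = refl
  const-* a b (suc k) = sym (trans (const-⊛ a (const b) (suc k)) (zeroʳ a))

  const-neg : ∀ a → const (- a) ≋ ⊝ const a
  const-neg a zero    = refl
  const-neg a (suc k) = sym -0#≈0#

  const-0 : const 0# ≋ 𝟘
  const-0 zero    = refl
  const-0 (suc k) = refl

  liftMorphism : ∀ {r₁ r₂} {Coeff : RawRing r₁ r₂} →
    Coeff -Raw-AlmostCommutative⟶ fromCommutativeRing R →
    Coeff -Raw-AlmostCommutative⟶ fromCommutativeRing commutativeRing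
  liftMorphism ι = record
    { ⟦_⟧    = λ a → const ⟦ a ⟧
    ; +-homo = λ a b k → trans (const-cong (+-homo a b) k) (const-+ ⟦ a ⟧ ⟦ b ⟧ k)
    ; *-homo = λ a b k → trans (const-cong (*-homo a b) k) (const-* ⟦ a ⟧ ⟦ b ⟧ k)
    ; -‿homo = λ a k → trans (const-cong (-‿homo a) k) (const-neg ⟦ a ⟧ k)
    ; 0-homo = λ k → trans (const-cong 0-homo k) (const-0 k)
    ; 1-homo = const-cong 1-homo
    }
    where open _-Raw-AlmostCommutative⟶_ ι

  open import Algebra.Properties.CommutativeSemigroup
    (CommutativeRing.*-commutativeSemigroup commutativeRing) using (x∙yz≈y∙xz)

  recurrence⇒powers : ∀ (P : ℕ → Series) c d → P 0 ≋ 𝟙 →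
    (∀ m → P (suc m) ≋ X ⊛ (P m ⊕ const c ⊛ P (suc m) ⊕ const d ⊛ P (suc (suc m)))) →
    ∀ m → P 1 ⊛ P m ≋ P (suc m)
  recurrence⇒powers P c d P₀≋𝟙 Pₛ m k = coefficient k m
    where
    -- By induction on the degree k, for all m at once: writing P (m+1) = X ⊛ step m,
    -- degree k+1 of P 1 ⊛ P (m+1) is degree k of P 1 ⊛ step m.
    combine : Series → Series → Series → Series
    combine f g h = f ⊕ const c ⊛ g ⊕ const d ⊛ h
    step : ℕ → Series
    step m = combine (P m) (P (suc m)) (P (suc (suc m)))
    combine-coefficient : ∀ f g h k → combine f g h k ≈ f k + c * g k + d * h k
    combine-coefficient f g h k = +-cong (+-congˡ (const-⊛ c g k)) (const-⊛ d h k)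
    P₁⊛ : ℕ → Series
    P₁⊛ m = P 1 ⊛ P m
    P₁⊛-step : ∀ m → P 1 ⊛ step m ≋ combine (P₁⊛ m) (P₁⊛ (suc m)) (P₁⊛ (suc (suc m)))
    P₁⊛-step m k = begin
      (P 1 ⊛ step m) k
        ≈⟨ ⊛-distribˡ (P 1) (P m ⊕ const c ⊛ P (suc m)) (const d ⊛ P (suc (suc m))) k ⟩
      (P 1 ⊛ (P m ⊕ const c ⊛ P (suc m))) k + (P 1 ⊛ (const d ⊛ P (suc (suc m)))) k
        ≈⟨ +-cong (⊛-distribˡ (P 1) (P m) (const c ⊛ P (suc m)) k)
                  (x∙yz≈y∙xz (P 1) (const d) (P (suc (suc m))) k) ⟩
      P₁⊛ m k + (P 1 ⊛ (const c ⊛ P (suc m))) k + (const d ⊛ P₁⊛ (suc (suc m))) k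
        ≈⟨ +-congʳ (+-congˡ (x∙yz≈y∙xz (P 1) (const c) (P (suc m)) k)) ⟩
      combine (P₁⊛ m) (P₁⊛ (suc m)) (P₁⊛ (suc (suc m))) k ∎
    vanishes-at-0 : ∀ m → P (suc m) zero ≈ 0#
    vanishes-at-0 m = trans (Pₛ m zero) (X⊛-zero (step m))
    coefficient : ∀ k m → P₁⊛ m k ≈ P (suc m) k
    coefficient k       zero    =
      trans (⊛-cong (λ _ → refl) P₀≋𝟙 k) (trans (⊛-comm (P 1) 𝟙 k) (⊛-identityˡ (P 1) k))
    coefficient zero    (suc m) =
      trans (*-congˡ (vanishes-at-0 m)) (trans (zeroʳ _) (sym (vanishes-at-0 (suc m))))
    coefficient (suc k) (suc m) = begin
      P₁⊛ (suc m) (suc k)                      ≈⟨ ⊛-cong (λ _ → refl) (Pₛ m) (suc k) ⟩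
      (P 1 ⊛ (X ⊛ step m)) (suc k)             ≈⟨ x∙yz≈y∙xz (P 1) X (step m) (suc k) ⟩
      (X ⊛ (P 1 ⊛ step m)) (suc k)             ≈⟨ X⊛-suc (P 1 ⊛ step m) k ⟩
      (P 1 ⊛ step m) k                         ≈⟨ P₁⊛-step m k ⟩
      combine (P₁⊛ m) (P₁⊛ (suc m)) (P₁⊛ (suc (suc m))) k
        ≈⟨ combine-coefficient (P₁⊛ m) (P₁⊛ (suc m)) (P₁⊛ (suc (suc m))) k ⟩
      P₁⊛ m k + c * P₁⊛ (suc m) k + d * P₁⊛ (suc (suc m)) k
        ≈⟨ +-cong (+-cong (coefficient k m) (*-congˡ (coefficient k (suc m))))
                  (*-congˡ (coefficient k (suc (suc m)))) ⟩
      P (suc m) k + c * P (suc (suc m)) k + d * P (suc (suc (suc m))) k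
        ≈⟨ combine-coefficient (P (suc m)) (P (suc (suc m))) (P (suc (suc (suc m)))) k ⟨
      step (suc m) k                           ≈⟨ X⊛-suc (step (suc m)) k ⟨
      (X ⊛ step (suc m)) (suc k)               ≈⟨ Pₛ (suc m) (suc k) ⟨
      P (suc (suc m)) (suc k)                  ∎

-- Opened only now, since inside FormalPowerSeries these names are the ring's.
open ≡ using (refl; cong; cong₂; sym; trans)

-- Polynomials in q and series over them

module ℤ[[q]] = FormalPowerSeries ℤₚ.+-*-commutativeRing

sumUpTo≡sum≤ : ∀ h k → sumUpTo h k ≡ ℤ[[q]].sum≤ h k
sumUpTo≡sum≤ h zero    = refl
sumUpTo≡sum≤ h (suc k) = cong (ℤ._+ h (suc k)) (sumUpTo≡sum≤ h k)

Poly-rawRing : RawRing 0ℓ 0ℓ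
Poly-rawRing = record
  { Carrier = Poly ; _≈_ = _≈ₚ_ ; _+_ = _+ₚ_ ; _*_ = _*ₚ_ ; -_ = -ₚ_ ; 0# = 0ₚ ; 1# = 1ₚ }

-- Defs' operations on Poly agree with those of ℤ[[q]] up to the convolution sum they use, so the
-- identity map is a ring monomorphism, which transports the ring laws.
Poly↪ℤ[[q]] : IsRingMonomorphism Poly-rawRing (CommutativeRing.rawRing ℤ[[q]].commutativeRing) id
Poly↪ℤ[[q]] = record
  { isRingHomomorphism = record
    { isSemiringHomomorphism = record
      { isNearSemiringHomomorphism = record
        { +-isMonoidHomomorphism = record
          { isMagmaHomomorphism = record
            { isRelHomomorphism = record { cong = id }
            ; homo = λ _ _ _ → refl }
          ; ε-homo = λ _ → refl }
        ; *-homo = λ f g k → sumUpTo≡sum≤ (λ i → f i ℤ.* g (k ∸ i)) k }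
      ; 1#-homo = λ { zero → refl ; (suc k) → refl } }
    ; -‿homo = λ _ _ → refl }
  ; injective = id }

Poly-commutativeRing : CommutativeRing 0ℓ 0ℓ
Poly-commutativeRing = record
  { isCommutativeRing = isCommutativeRing (CommutativeRing.isCommutativeRing ℤ[[q]].commutativeRing) }
  where open import Algebra.Morphism.RingMonomorphism Poly↪ℤ[[q]]

module P = CommutativeRing Poly-commutativeRing

-- The ring solver needs a decidable coefficient equality, which series rings lack; integer
-- coefficients, mapped in through a ring morphism, provide it.
module ℤ-CoefficientSolver (R : CommutativeRing 0ℓ 0ℓ)
  (ι : ℤ.+-*-rawRing -Raw-AlmostCommutative⟶ fromCommutativeRing R) where
  open CommutativeRing R using (reflexive)
  open _-Raw-AlmostCommutative⟶_ ι using (⟦_⟧)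
  open import Algebra.Solver.Ring ℤ.+-*-rawRing (fromCommutativeRing R) ι
    (λ a b → mapMaybe (λ a≡b → reflexive (cong ⟦_⟧ a≡b)) (dec⇒maybe (a ℤₚ.≟ b))) public

ℤ→Poly : ℤ.+-*-rawRing -Raw-AlmostCommutative⟶ fromCommutativeRing Poly-commutativeRing
ℤ→Poly = record
  { ⟦_⟧    = ℤ[[q]].const
  ; +-homo = +-homo
  ; *-homo = λ a b k → trans (*-homo a b k) (sym (sumUpTo≡sum≤ _ k))
  ; -‿homo = -‿homo
  ; 0-homo = 0-homo
  ; 1-homo = λ { zero → refl ; (suc k) → refl }
  }
  where
  open _-Raw-AlmostCommutative⟶_
    (ℤ[[q]].liftMorphism (-raw-almostCommutative⟶ (fromCommutativeRing ℤₚ.+-*-commutativeRing)))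

module Poly-Solver = ℤ-CoefficientSolver Poly-commutativeRing ℤ→Poly

qₚ≈X : qₚ ≈ₚ ℤ[[q]].X
qₚ≈X zero          = refl
qₚ≈X (suc zero)    = refl
qₚ≈X (suc (suc k)) = refl

qₚ*ₚ-suc : ∀ f k → (qₚ *ₚ f) (suc k) ≡ f k
qₚ*ₚ-suc f k = trans (sumUpTo≡sum≤ _ (suc k))
  (trans (ℤ[[q]].⊛-cong {g = f} qₚ≈X (λ _ → refl) (suc k)) (ℤ[[q]].X⊛-suc f k))

module Poly[[x]] = FormalPowerSeries Poly-commutativeRing
open Poly[[x]]
module S = CommutativeRing Poly[[x]].commutativeRing
module Poly[[x]]-Solver = ℤ-CoefficientSolver Poly[[x]].commutativeRing (liftMorphism ℤ→Poly)

-- The Narayana generating function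

[1+k]*[1+n]C[1+k]≡[1+n]*nCk : ∀ n k → suc k ℕ.* (suc n C suc k) ≡ suc n ℕ.* (n C k)
[1+k]*[1+n]C[1+k]≡[1+n]*nCk zero    zero    = refl
[1+k]*[1+n]C[1+k]≡[1+n]*nCk zero    (suc k) = ℕₚ.*-zeroʳ (suc (suc k))
[1+k]*[1+n]C[1+k]≡[1+n]*nCk (suc n) zero    =
  trans (ℕₚ.+-identityʳ _) (trans (nC1≡n (suc (suc n))) (sym (ℕₚ.*-identityʳ (suc (suc n)))))
[1+k]*[1+n]C[1+k]≡[1+n]*nCk (suc n) (suc k) = begin
  (2 ℕ.+ k) ℕ.* (suc (suc n) C suc (suc k))
    ≡⟨ cong ((2 ℕ.+ k) ℕ.*_) (sym (nCk+nC[k+1]≡[n+1]C[k+1] (suc n) (suc k))) ⟩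
  (2 ℕ.+ k) ℕ.* (suc n C suc k ℕ.+ suc n C suc (suc k))
    ≡⟨ split (suc n C suc k) (suc n C suc (suc k)) k ⟩
  suc k ℕ.* (suc n C suc k) ℕ.+ suc n C suc k ℕ.+ (2 ℕ.+ k) ℕ.* (suc n C suc (suc k))
    ≡⟨ cong₂ (λ a b → a ℕ.+ suc n C suc k ℕ.+ b)
             ([1+k]*[1+n]C[1+k]≡[1+n]*nCk n k) ([1+k]*[1+n]C[1+k]≡[1+n]*nCk n (suc k)) ⟩
  suc n ℕ.* (n C k) ℕ.+ suc n C suc k ℕ.+ suc n ℕ.* (n C suc k)
    ≡⟨ collect (n C k) (suc n C suc k) (n C suc k) n ⟩
  suc n ℕ.* (n C k ℕ.+ n C suc k) ℕ.+ suc n C suc k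
    ≡⟨ cong (λ a → suc n ℕ.* a ℕ.+ suc n C suc k) (nCk+nC[k+1]≡[n+1]C[k+1] n k) ⟩
  suc n ℕ.* (suc n C suc k) ℕ.+ suc n C suc k
    ≡⟨ ℕₚ.+-comm (suc n ℕ.* (suc n C suc k)) _ ⟩
  (2 ℕ.+ n) ℕ.* (suc n C suc k) ∎
  where
  open ≡.≡-Reasoning
  split : ∀ a b k → (2 ℕ.+ k) ℕ.* (a ℕ.+ b) ≡ (1 ℕ.+ k) ℕ.* a ℕ.+ a ℕ.+ (2 ℕ.+ k) ℕ.* b
  split = ℕ-Solver.solve-∀
  collect : ∀ a b c n → (1 ℕ.+ n) ℕ.* a ℕ.+ b ℕ.+ (1 ℕ.+ n) ℕ.* c ≡ (1 ℕ.+ n) ℕ.* (a ℕ.+ c) ℕ.+ b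
  collect = ℕ-Solver.solve-∀

-- C⁻ n j = C(n, j - 1): the shift makes C(n, -1) = 0 available as C⁻ n 0.
C⁻ : ℕ → ℕ → ℤ
C⁻ n zero    = + 0
C⁻ n (suc j) = + (n C j)

C⁻-pascal : ∀ n j → C⁻ (suc n) (suc j) ≡ C⁻ n j ℤ.+ C⁻ n (suc j)
C⁻-pascal n zero    = refl
C⁻-pascal n (suc j) =
  trans (cong +_ (sym (nCk+nC[k+1]≡[n+1]C[k+1] n j))) (ℤₚ.pos-+ (n C j) (n C suc j))

C⁻-absorb : ∀ n j → + j ℤ.* C⁻ (suc n) (suc j) ≡ + suc n ℤ.* C⁻ n j
C⁻-absorb n zero    = sym (ℤₚ.*-zeroʳ (+ suc n))
C⁻-absorb n (suc j) = begin
  + suc j ℤ.* + (suc n C suc j)  ≡⟨ ℤₚ.pos-* (suc j) _ ⟨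
  + (suc j ℕ.* (suc n C suc j))  ≡⟨ cong +_ ([1+k]*[1+n]C[1+k]≡[1+n]*nCk n j) ⟩
  + (suc n ℕ.* (n C j))          ≡⟨ ℤₚ.pos-* (suc n) _ ⟩
  + suc n ℤ.* + (n C j)          ∎
  where open ≡.≡-Reasoning

minor : (ℕ → ℤ) → ℕ → ℕ → ℤ
minor b m k = b (suc k) ℤ.* b (m ℕ.+ k) ℤ.- b k ℤ.* b (suc (m ℕ.+ k))

module _ (b b′ : ℕ → ℤ) (pascal : ∀ j → b′ (suc j) ≡ b j ℤ.+ b (suc j)) where

  minor-pascal-suc : ∀ m k →
    minor b′ (suc m) (suc k) ≡
      minor b m (suc k) ℤ.+ minor b (suc m) (suc k) ℤ.+ (minor b (suc m) k ℤ.+ minor b (suc (suc m)) k)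
  minor-pascal-suc m k
    rewrite ℕₚ.+-suc m k
          | pascal k | pascal (suc k) | pascal (suc (m ℕ.+ k)) | pascal (suc (suc (m ℕ.+ k))) =
    expand (b k) (b (suc k)) (b (suc (suc k)))
           (b (suc (m ℕ.+ k))) (b (suc (suc (m ℕ.+ k)))) (b (suc (suc (suc (m ℕ.+ k)))))
    where
    expand : ∀ x₀ x₁ x₂ y₁ y₂ y₃ →
      (x₁ ℤ.+ x₂) ℤ.* (y₁ ℤ.+ y₂) ℤ.- (x₀ ℤ.+ x₁) ℤ.* (y₂ ℤ.+ y₃)
        ≡ x₂ ℤ.* y₁ ℤ.- x₁ ℤ.* y₂ ℤ.+ (x₂ ℤ.* y₂ ℤ.- x₁ ℤ.* y₃)
          ℤ.+ (x₁ ℤ.* y₁ ℤ.- x₀ ℤ.* y₂ ℤ.+ (x₁ ℤ.* y₂ ℤ.- x₀ ℤ.* y₃))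
    expand = ℤ-Solver.solve-∀

  minor-pascal-zero : b 0 ≡ + 0 → b′ 0 ≡ + 0 → ∀ m →
    minor b′ (suc m) 0 ≡ minor b m 0 ℤ.+ minor b (suc m) 0
  minor-pascal-zero b₀≡0 b′₀≡0 m
    rewrite ℕₚ.+-identityʳ m | b′₀≡0 | pascal 0 | pascal m | b₀≡0 =
    expand (b 1) (b m) (b (suc m)) (b (suc (suc m))) (b′ (suc (suc m)))
    where
    expand : ∀ x y₀ y₁ y₂ z →
      (+ 0 ℤ.+ x) ℤ.* (y₀ ℤ.+ y₁) ℤ.- + 0 ℤ.* z
        ≡ x ℤ.* y₀ ℤ.- + 0 ℤ.* y₁ ℤ.+ (x ℤ.* y₁ ℤ.- + 0 ℤ.* y₂)
    expand = ℤ-Solver.solve-∀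

-- narayanaPower m n = [xⁿ] (x N)ᵐ for N = Σₙ Cat(Aₙ;q) xⁿ (narayanaPower-one and recurrence⇒powers),
-- in closed form: for n ≥ 1 its q^k coefficient is the binomial minor
-- C(n-1,k) C(n-1,m+k-1) - C(n-1,k-1) C(n-1,m+k), as for ballot numbers.
narayanaPower : ℕ → ℕ → Poly
narayanaPower m       (suc n) = minor (C⁻ n) m
narayanaPower zero    zero    = 1ₚ
narayanaPower (suc m) zero    = 0ₚ

narayanaPower-zero : narayanaPower 0 ≋ 𝟙
narayanaPower-zero zero     = P.refl
narayanaPower-zero (suc n) k = cancel (C⁻ n (suc k)) (C⁻ n k)
  where
  cancel : ∀ x y → x ℤ.* y ℤ.- y ℤ.* x ≡ + 0
  cancel = ℤ-Solver.solve-∀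

narayanaPower-suc-one : ∀ m → narayanaPower (suc m) 1 ≈ₚ narayanaPower m 0
narayanaPower-suc-one = coefficient
  where
  vanish : ∀ x y → x ℤ.* + 0 ℤ.- y ℤ.* + 0 ≡ + 0
  vanish = ℤ-Solver.solve-∀
  coefficient : ∀ m → narayanaPower (suc m) 1 ≈ₚ narayanaPower m 0
  coefficient zero    zero    = refl
  coefficient zero    (suc k) = vanish (+ 0) (C⁻ 0 (suc k))
  coefficient (suc m) k       = vanish (C⁻ 0 (suc k)) (C⁻ 0 k)

narayanaPower-pascal : ∀ m n →
  narayanaPower (suc m) (suc n) ≈ₚ
    narayanaPower m n +ₚ narayanaPower (suc m) n
      +ₚ qₚ *ₚ (narayanaPower (suc m) n +ₚ narayanaPower (suc (suc m)) n)
narayanaPower-pascal m zero = P.trans (narayanaPower-suc-one m) (P.sym (drop-zeros (narayanaPower m 0) qₚ))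
  where
  drop-zeros : ∀ p q → p +ₚ 0ₚ +ₚ q *ₚ (0ₚ +ₚ 0ₚ) ≈ₚ p
  drop-zeros p q =
    P.trans (P.+-cong (P.+-identityʳ p) (P.trans (P.*-congˡ {q} (P.+-identityʳ 0ₚ)) (P.zeroʳ q))) (P.+-identityʳ p)
narayanaPower-pascal m (suc n) zero    =
  trans (minor-pascal-zero (C⁻ n) (C⁻ (suc n)) (C⁻-pascal n) refl refl m)
        (sym (ℤₚ.+-identityʳ (minor (C⁻ n) m 0 ℤ.+ minor (C⁻ n) (suc m) 0)))
narayanaPower-pascal m (suc n) (suc k) =
  trans (minor-pascal-suc (C⁻ n) (C⁻ (suc n)) (C⁻-pascal n) m k)
        (cong (λ z → minor (C⁻ n) m (suc k) ℤ.+ minor (C⁻ n) (suc m) (suc k) ℤ.+ z)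
              (sym (qₚ*ₚ-suc (narayanaPower (suc m) (suc n) +ₚ narayanaPower (suc (suc m)) (suc n)) k)))

[1+q] [q] : Series
[1+q] = const (1ₚ +ₚ qₚ)
[q]   = const qₚ

narayanaPower-recurrence : ∀ m →
  narayanaPower (suc m) ≋
    X ⊛ (narayanaPower m ⊕ [1+q] ⊛ narayanaPower (suc m) ⊕ [q] ⊛ narayanaPower (suc (suc m)))
narayanaPower-recurrence m zero    = P.sym (X⊛-zero step)
  where
  step : Series
  step = narayanaPower m ⊕ [1+q] ⊛ narayanaPower (suc m) ⊕ [q] ⊛ narayanaPower (suc (suc m))
narayanaPower-recurrence m (suc n) = begin
  narayanaPower (suc m) (suc n)
    ≈⟨ narayanaPower-pascal m n ⟩
  p +ₚ r +ₚ qₚ *ₚ (r +ₚ s)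
    ≈⟨ regroup p r s qₚ ⟨
  p +ₚ (r +ₚ qₚ *ₚ r) +ₚ qₚ *ₚ s
    ≈⟨ P.+-congʳ {qₚ *ₚ s} (P.+-congˡ {p}
         (P.trans (P.distribʳ r 1ₚ qₚ) (P.+-congʳ {qₚ *ₚ r} (P.*-identityˡ r)))) ⟨
  p +ₚ (1ₚ +ₚ qₚ) *ₚ r +ₚ qₚ *ₚ s
    ≈⟨ P.+-cong (P.+-congˡ {p} (const-⊛ (1ₚ +ₚ qₚ) (narayanaPower (suc m)) n))
                (const-⊛ qₚ (narayanaPower (suc (suc m))) n) ⟨
  step n
    ≈⟨ X⊛-suc step n ⟨
  (X ⊛ step) (suc n) ∎
  where
  open import Relation.Binary.Reasoning.Setoid P.setoid
  p r s : Poly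
  p = narayanaPower m n
  r = narayanaPower (suc m) n
  s = narayanaPower (suc (suc m)) n
  step : Series
  step = narayanaPower m ⊕ [1+q] ⊛ narayanaPower (suc m) ⊕ [q] ⊛ narayanaPower (suc (suc m))
  regroup : ∀ p r s q → p +ₚ (r +ₚ q *ₚ r) +ₚ q *ₚ s ≈ₚ p +ₚ r +ₚ q *ₚ (r +ₚ s)
  regroup = solve 4 (λ p r s q → p :+ (r :+ q :* r) :+ q :* s := p :+ r :+ q :* (r :+ s)) P.refl
    where open Poly-Solver

exact-division : ∀ n (z : ℤ) m → + suc n ℤ.* z ≡ + m → + (m / suc n) ≡ z
exact-division n (+ v)      m [1+n]*v≡m = cong +_ (begin
  m / suc n              ≡⟨ cong (_/ suc n) (ℤₚ.+-injective (trans (ℤₚ.pos-* (suc n) v) [1+n]*v≡m)) ⟨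
  suc n ℕ.* v / suc n    ≡⟨ cong (_/ suc n) (ℕₚ.*-comm (suc n) v) ⟩
  v ℕ.* suc n / suc n    ≡⟨ m*n/n≡m v (suc n) ⟩
  v                      ∎)
  where open ≡.≡-Reasoning
exact-division n -[1+ w ] m ()

narayanaPower-one-formula : ∀ n k → + suc n ℤ.* narayanaPower 1 (suc n) k ≡ + ((suc n C k) ℕ.* (suc n C suc k))
narayanaPower-one-formula n k = begin
  N ℤ.* (b ℤ.* b ℤ.- a ℤ.* c)
    ≡⟨ factor N a b c ⟩
  (a ℤ.+ b) ℤ.* (N ℤ.* b) ℤ.- (N ℤ.* a) ℤ.* (b ℤ.+ c)
    ≡⟨ cong₂ (λ x y → x ℤ.* (N ℤ.* b) ℤ.- (N ℤ.* a) ℤ.* y)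
             (sym (C⁻-pascal n k)) (sym (C⁻-pascal n (suc k))) ⟩
  A ℤ.* (N ℤ.* b) ℤ.- (N ℤ.* a) ℤ.* B
    ≡⟨ cong₂ (λ x y → A ℤ.* x ℤ.- y ℤ.* B) (sym (C⁻-absorb n (suc k))) (sym (C⁻-absorb n k)) ⟩
  A ℤ.* ((+ 1 ℤ.+ + k) ℤ.* B) ℤ.- (+ k ℤ.* A) ℤ.* B
    ≡⟨ telescope A B (+ k) ⟩
  A ℤ.* B
    ≡⟨ ℤₚ.pos-* (suc n C k) (suc n C suc k) ⟨
  + ((suc n C k) ℕ.* (suc n C suc k)) ∎
  where
  open ≡.≡-Reasoning
  N a b c A B : ℤ
  N = + suc n
  a = C⁻ n k
  b = C⁻ n (suc k)
  c = C⁻ n (suc (suc k))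
  A = C⁻ (suc n) (suc k)
  B = C⁻ (suc n) (suc (suc k))
  factor : ∀ N a b c →
    N ℤ.* (b ℤ.* b ℤ.- a ℤ.* c) ≡ (a ℤ.+ b) ℤ.* (N ℤ.* b) ℤ.- (N ℤ.* a) ℤ.* (b ℤ.+ c)
  factor = ℤ-Solver.solve-∀
  telescope : ∀ A B K → A ℤ.* ((+ 1 ℤ.+ K) ℤ.* B) ℤ.- (K ℤ.* A) ℤ.* B ≡ A ℤ.* B
  telescope = ℤ-Solver.solve-∀

narayanaPower-one : narayanaPower 1 ≋ X ⊛ CatA
narayanaPower-one zero    = P.sym (X⊛-zero CatA)
narayanaPower-one (suc n) k = trans
  (sym (exact-division n (narayanaPower 1 (suc n) k) _ (narayanaPower-one-formula n k)))
  (sym (X⊛-suc CatA n k))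

narayana-quadratic : CatA ≋ 𝟙 ⊕ [1+q] ⊛ (X ⊛ CatA) ⊕ [q] ⊛ ((X ⊛ CatA) ⊛ (X ⊛ CatA))
narayana-quadratic = X⊛-cancel (begin
  X ⊛ CatA          ≈⟨ narayanaPower-one ⟨
  narayanaPower 1   ≈⟨ narayanaPower-recurrence 0 ⟩
  X ⊛ (narayanaPower 0 ⊕ [1+q] ⊛ narayanaPower 1 ⊕ [q] ⊛ narayanaPower 2)
    ≈⟨ S.*-congˡ {X} (S.+-cong (S.+-cong narayanaPower-zero (S.*-congˡ {[1+q]} narayanaPower-one))
                               (S.*-congˡ {[q]} square)) ⟩
  X ⊛ (𝟙 ⊕ [1+q] ⊛ (X ⊛ CatA) ⊕ [q] ⊛ ((X ⊛ CatA) ⊛ (X ⊛ CatA))) ∎)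
  where
  open import Relation.Binary.Reasoning.Setoid S.setoid
  square : narayanaPower 2 ≋ (X ⊛ CatA) ⊛ (X ⊛ CatA)
  square = S.trans
    (S.sym (recurrence⇒powers narayanaPower (1ₚ +ₚ qₚ) qₚ narayanaPower-zero narayanaPower-recurrence 1))
    (S.*-cong narayanaPower-one narayanaPower-one)

-- Cat⁺⁺ as a weighted sum over subsets of the simple reflections

filterᵇ-map : ∀ {A B : Set} (p : B → Bool) (g : A → B) xs →
  filterᵇ p (map g xs) ≡ map g (filterᵇ (p ∘ g) xs)
filterᵇ-map p g []       = refl
filterᵇ-map p g (x ∷ xs) with p (g x)
... | true  = cong (g x ∷_) (filterᵇ-map p g xs)
... | false = filterᵇ-map p g xs

filterᵇ-false : ∀ {A : Set} (xs : List A) → filterᵇ (λ _ → false) xs ≡ []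
filterᵇ-false []       = refl
filterᵇ-false (x ∷ xs) = filterᵇ-false xs

subsetsOf-false : ∀ {n} (J : Subset n) → subsetsOf (false ∷ J) ≡ map (false ∷_) (subsetsOf J)
subsetsOf-false {n} J = begin
  filterᵇ (_⊆ᵇ (false ∷ J)) (map (false ∷_) all ++ map (true ∷_) all)
    ≡⟨ Listₚ.filter-++ _ (map (false ∷_) all) (map (true ∷_) all) ⟩
  filterᵇ (_⊆ᵇ (false ∷ J)) (map (false ∷_) all) ++ filterᵇ (_⊆ᵇ (false ∷ J)) (map (true ∷_) all)
    ≡⟨ cong₂ _++_ (filterᵇ-map _ (false ∷_) all)
                  (trans (filterᵇ-map _ (true ∷_) all) (cong (map (true ∷_)) (filterᵇ-false all))) ⟩
  map (false ∷_) (subsetsOf J) ++ []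
    ≡⟨ Listₚ.++-identityʳ _ ⟩
  map (false ∷_) (subsetsOf J) ∎
  where
  open ≡.≡-Reasoning
  all : List (Subset n)
  all = allSubsets n

subsetsOf-true : ∀ {n} (J : Subset n) →
  subsetsOf (true ∷ J) ≡ map (false ∷_) (subsetsOf J) ++ map (true ∷_) (subsetsOf J)
subsetsOf-true {n} J =
  trans (Listₚ.filter-++ _ (map (false ∷_) (allSubsets n)) (map (true ∷_) (allSubsets n)))
        (cong₂ _++_ (filterᵇ-map _ (false ∷_) (allSubsets n)) (filterᵇ-map _ (true ∷_) (allSubsets n)))

subsetsOf-full : ∀ n → subsetsOf (replicate n true) ≡ allSubsets n
subsetsOf-full zero    = refl
subsetsOf-full (suc n) =
  trans (subsetsOf-true (replicate n true))
        (cong (λ Ks → map (false ∷_) Ks ++ map (true ∷_) Ks) (subsetsOf-full n))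

card-full : ∀ n → card (replicate n true) ≡ n
card-full zero    = refl
card-full (suc n) = cong suc (card-full n)

subsetsOf-card≤ : ∀ {n} (J : Subset n) → All (λ K → card K ≤ card J) (subsetsOf J)
subsetsOf-card≤ []          = z≤n ∷ []
subsetsOf-card≤ (false ∷ J) rewrite subsetsOf-false J = Allₚ.map⁺ (subsetsOf-card≤ J)
subsetsOf-card≤ (true ∷ J)  rewrite subsetsOf-true J =
  Allₚ.++⁺ (Allₚ.map⁺ (All.map ℕₚ.m≤n⇒m≤1+n (subsetsOf-card≤ J)))
           (Allₚ.map⁺ (All.map s≤s (subsetsOf-card≤ J)))

sumₚ-++ : ∀ xs ys → sumₚ (xs ++ ys) ≈ₚ sumₚ xs +ₚ sumₚ ys
sumₚ-++ []       ys = P.sym (P.+-identityˡ (sumₚ ys))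
sumₚ-++ (x ∷ xs) ys = P.trans (P.+-congˡ {x} (sumₚ-++ xs ys)) (P.sym (P.+-assoc x (sumₚ xs) (sumₚ ys)))

sumₚ-map-*ˡ : ∀ {A : Set} a (f : A → Poly) xs →
  sumₚ (map (λ x → a *ₚ f x) xs) ≈ₚ a *ₚ sumₚ (map f xs)
sumₚ-map-*ˡ a f []       = P.sym (P.zeroʳ a)
sumₚ-map-*ˡ a f (x ∷ xs) =
  P.trans (P.+-congˡ {a *ₚ f x} (sumₚ-map-*ˡ a f xs)) (P.sym (P.distribˡ a (f x) (sumₚ (map f xs))))

sumₚ-map-congᴬ : ∀ {A : Set} {f g : A → Poly} {xs} →
  All (λ x → f x ≈ₚ g x) xs → sumₚ (map f xs) ≈ₚ sumₚ (map g xs)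
sumₚ-map-congᴬ []                = P.refl
sumₚ-map-congᴬ (fx≈gx ∷ fxs≈gxs) = P.+-cong fx≈gx (sumₚ-map-congᴬ fxs≈gxs)

-- subsetSum w n Φ = Σ_{K ⊆ S} w^{n-|K|} Φ K, recursing on the first simple reflection.
subsetSum : Poly → (n : ℕ) → (Subset n → Poly) → Poly
subsetSum w zero    Φ = Φ []
subsetSum w (suc n) Φ = w *ₚ subsetSum w n (Φ ∘ (false ∷_)) +ₚ subsetSum w n (Φ ∘ (true ∷_))

subsetSum-cong : ∀ {w w′} n {Φ Ψ : Subset n → Poly} → w ≈ₚ w′ → (∀ K → Φ K ≈ₚ Ψ K) →
  subsetSum w n Φ ≈ₚ subsetSum w′ n Ψ
subsetSum-cong zero    w≈w′ Φ≈Ψ = Φ≈Ψ []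
subsetSum-cong (suc n) w≈w′ Φ≈Ψ =
  P.+-cong (P.*-cong w≈w′ (subsetSum-cong n w≈w′ (Φ≈Ψ ∘ (false ∷_))))
           (subsetSum-cong n w≈w′ (Φ≈Ψ ∘ (true ∷_)))

subsetSum-+ : ∀ w n (Φ Ψ : Subset n → Poly) →
  subsetSum w n (λ K → Φ K +ₚ Ψ K) ≈ₚ subsetSum w n Φ +ₚ subsetSum w n Ψ
subsetSum-+ w zero    Φ Ψ = P.refl
subsetSum-+ w (suc n) Φ Ψ = P.trans
  (P.+-cong (P.*-congˡ {w} (subsetSum-+ w n (Φ ∘ (false ∷_)) (Ψ ∘ (false ∷_))))
            (subsetSum-+ w n (Φ ∘ (true ∷_)) (Ψ ∘ (true ∷_))))
  (shuffle w (S Φ false) (S Ψ false) (S Φ true) (S Ψ true))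
  where
  S : (Subset (suc n) → Poly) → Bool → Poly
  S Θ b = subsetSum w n (Θ ∘ (b ∷_))
  shuffle : ∀ w a b c d → w *ₚ (a +ₚ b) +ₚ (c +ₚ d) ≈ₚ w *ₚ a +ₚ c +ₚ (w *ₚ b +ₚ d)
  shuffle = solve 5 (λ w a b c d → w :* (a :+ b) :+ (c :+ d) := w :* a :+ c :+ (w :* b :+ d)) P.refl
    where open Poly-Solver

subsetSum-*ˡ : ∀ w n a (Φ : Subset n → Poly) → subsetSum w n (λ K → a *ₚ Φ K) ≈ₚ a *ₚ subsetSum w n Φ
subsetSum-*ˡ w zero    a Φ = P.refl
subsetSum-*ˡ w (suc n) a Φ = P.trans
  (P.+-cong (P.*-congˡ {w} (subsetSum-*ˡ w n a (Φ ∘ (false ∷_)))) (subsetSum-*ˡ w n a (Φ ∘ (true ∷_))))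
  (shuffle w a (subsetSum w n (Φ ∘ (false ∷_))) (subsetSum w n (Φ ∘ (true ∷_))))
  where
  shuffle : ∀ w a b c → w *ₚ (a *ₚ b) +ₚ a *ₚ c ≈ₚ a *ₚ (w *ₚ b +ₚ c)
  shuffle = solve 4 (λ w a b c → w :* (a :* b) :+ a :* c := a :* (w :* b :+ c)) P.refl
    where open Poly-Solver

sumBelow : ∀ {n} → Poly → Subset n → (Subset n → Poly) → Poly
sumBelow u J Φ = sumₚ (map (λ K → (u ^ₚ (card J ∸ card K)) *ₚ Φ K) (subsetsOf J))

sumBelow-false : ∀ {n} u (J : Subset n) Φ → sumBelow u (false ∷ J) Φ ≡ sumBelow u J (Φ ∘ (false ∷_))
sumBelow-false u J Φ =
  trans (cong (sumₚ ∘ map (λ K → (u ^ₚ (card J ∸ card K)) *ₚ Φ K)) (subsetsOf-false J))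
        (cong sumₚ (sym (Listₚ.map-∘ (subsetsOf J))))

sumBelow-true : ∀ {n} u (J : Subset n) Φ →
  sumBelow u (true ∷ J) Φ ≈ₚ u *ₚ sumBelow u J (Φ ∘ (false ∷_)) +ₚ sumBelow u J (Φ ∘ (true ∷_))
sumBelow-true u J Φ = begin
  sumₚ (map term (subsetsOf (true ∷ J)))
    ≡⟨ cong (sumₚ ∘ map term) (subsetsOf-true J) ⟩
  sumₚ (map term (map (false ∷_) (subsetsOf J) ++ map (true ∷_) (subsetsOf J)))
    ≡⟨ cong sumₚ (Listₚ.map-++ term (map (false ∷_) (subsetsOf J)) (map (true ∷_) (subsetsOf J))) ⟩
  sumₚ (map term (map (false ∷_) (subsetsOf J)) ++ map term (map (true ∷_) (subsetsOf J)))
    ≈⟨ sumₚ-++ (map term (map (false ∷_) (subsetsOf J))) (map term (map (true ∷_) (subsetsOf J))) ⟩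
  sumₚ (map term (map (false ∷_) (subsetsOf J))) +ₚ sumₚ (map term (map (true ∷_) (subsetsOf J)))
    ≡⟨ cong₂ _+ₚ_ (cong sumₚ (sym (Listₚ.map-∘ (subsetsOf J))))
                  (cong sumₚ (sym (Listₚ.map-∘ (subsetsOf J)))) ⟩
  sumₚ (map (term ∘ (false ∷_)) (subsetsOf J)) +ₚ sumBelow u J (Φ ∘ (true ∷_))
    ≈⟨ P.+-congʳ {sumBelow u J (Φ ∘ (true ∷_))}
         (P.trans (sumₚ-map-congᴬ (All.map (λ {K} → extract-u {K}) (subsetsOf-card≤ J)))
                  (sumₚ-map-*ˡ u below (subsetsOf J))) ⟩
  u *ₚ sumBelow u J (Φ ∘ (false ∷_)) +ₚ sumBelow u J (Φ ∘ (true ∷_)) ∎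
  where
  open import Relation.Binary.Reasoning.Setoid P.setoid
  term : Subset _ → Poly
  term K = (u ^ₚ (card (true ∷ J) ∸ card K)) *ₚ Φ K
  below : Subset _ → Poly
  below K = (u ^ₚ (card J ∸ card K)) *ₚ Φ (false ∷ K)
  extract-u : ∀ {K} → card K ≤ card J → term (false ∷ K) ≈ₚ u *ₚ below K
  extract-u {K} K≤J rewrite ℕₚ.+-∸-assoc 1 K≤J = P.*-assoc u (u ^ₚ (card J ∸ card K)) (Φ (false ∷ K))

sumBelow-full : ∀ n u Φ → sumBelow u (replicate n true) Φ ≈ₚ subsetSum u n Φ
sumBelow-full zero    u Φ = P.trans (P.+-identityʳ (1ₚ *ₚ Φ [])) (P.*-identityˡ (Φ []))
sumBelow-full (suc n) u Φ = P.trans (sumBelow-true u (replicate n true) Φ)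
  (P.+-cong (P.*-congˡ {u} (sumBelow-full n u (Φ ∘ (false ∷_)))) (sumBelow-full n u (Φ ∘ (true ∷_))))

sumBelow-full≡sum-allSubsets : ∀ n u Φ →
  sumBelow u (replicate n true) Φ ≡ sumₚ (map (λ K → (u ^ₚ (n ∸ card K)) *ₚ Φ K) (allSubsets n))
sumBelow-full≡sum-allSubsets n u Φ =
  cong₂ (λ m Ks → sumₚ (map (λ K → (u ^ₚ (m ∸ card K)) *ₚ Φ K) Ks)) (card-full n) (subsetsOf-full n)

subsetSum-sumBelow : ∀ w u n Φ → subsetSum w n (λ J → sumBelow u J Φ) ≈ₚ subsetSum (w +ₚ u) n Φ
subsetSum-sumBelow w u zero    Φ = sumBelow-full zero u Φ
subsetSum-sumBelow w u (suc n) Φ = begin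
  w *ₚ subsetSum w n (λ J → sumBelow u (false ∷ J) Φ) +ₚ subsetSum w n (λ J → sumBelow u (true ∷ J) Φ)
    ≈⟨ P.+-cong (P.*-congˡ {w} (subsetSum-cong n P.refl (λ J → P.reflexive (sumBelow-false u J Φ))))
                (subsetSum-cong n P.refl (λ J → sumBelow-true u J Φ)) ⟩
  w *ₚ Sf +ₚ subsetSum w n (λ J → u *ₚ sumBelow u J Φf +ₚ sumBelow u J Φt)
    ≈⟨ P.+-congˡ {w *ₚ Sf} (P.trans (subsetSum-+ w n _ _) (P.+-congʳ {St} (subsetSum-*ˡ w n u _))) ⟩
  w *ₚ Sf +ₚ (u *ₚ Sf +ₚ St)
    ≈⟨ P.trans (P.sym (P.+-assoc (w *ₚ Sf) (u *ₚ Sf) St)) (P.+-congʳ {St} (P.sym (P.distribʳ Sf w u))) ⟩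
  (w +ₚ u) *ₚ Sf +ₚ St
    ≈⟨ P.+-cong (P.*-congˡ {w +ₚ u} (subsetSum-sumBelow w u n Φf)) (subsetSum-sumBelow w u n Φt) ⟩
  subsetSum (w +ₚ u) (suc n) Φ ∎
  where
  open import Relation.Binary.Reasoning.Setoid P.setoid
  Φf Φt : Subset _ → Poly
  Φf = Φ ∘ (false ∷_)
  Φt = Φ ∘ (true ∷_)
  Sf St : Poly
  Sf = subsetSum w n (λ J → sumBelow u J Φf)
  St = subsetSum w n (λ J → sumBelow u J Φt)

t : Poly
t = -ₚ (1ₚ +ₚ qₚ)

CatPlusPlusA≈subsetSum : ∀ n → CatPlusPlusA n ≈ₚ subsetSum t n CatPar
CatPlusPlusA≈subsetSum n = begin
  CatPlusPlusA n                                         ≡⟨ sumBelow-full≡sum-allSubsets n (-ₚ qₚ) CatPlusPar ⟨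
  sumBelow (-ₚ qₚ) (replicate n true) CatPlusPar         ≈⟨ sumBelow-full n (-ₚ qₚ) CatPlusPar ⟩
  subsetSum (-ₚ qₚ) n (λ J → sumBelow (-ₚ 1ₚ) J CatPar)  ≈⟨ subsetSum-sumBelow (-ₚ qₚ) (-ₚ 1ₚ) n CatPar ⟩
  subsetSum (-ₚ qₚ +ₚ -ₚ 1ₚ) n CatPar                    ≈⟨ subsetSum-cong n (negate-sum qₚ 1ₚ) (λ _ → P.refl) ⟩
  subsetSum t n CatPar                                   ∎
  where
  open import Relation.Binary.Reasoning.Setoid P.setoid
  negate-sum : ∀ a b → -ₚ a +ₚ -ₚ b ≈ₚ -ₚ (b +ₚ a)
  negate-sum = solve 2 (λ a b → :- a :+ :- b := :- (b :+ a)) P.refl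
    where open Poly-Solver

-- The generating function of Cat⁺⁺

-- catRuns r K = Cat(W_K) for the diagram with r further generators prepended to the first run of K.
catRuns : ∀ {n} → ℕ → Subset n → Poly
catRuns r []          = CatA r
catRuns r (false ∷ K) = CatA r *ₚ catRuns 0 K
catRuns r (true ∷ K)  = catRuns (suc r) K

runs-true : ∀ bs {x xs} → runs bs ≡ x ∷ xs → runs (true ∷ bs) ≡ suc x ∷ xs
runs-true bs runs≡ with runs bs | runs≡
... | _ ∷ _ | refl = refl

runs-nonempty : ∀ bs → ∃₂ λ x xs → runs bs ≡ x ∷ xs
runs-nonempty []           = 0 , [] , refl
runs-nonempty (false ∷ bs) = 0 , runs bs , refl
runs-nonempty (true ∷ bs)  with runs-nonempty bs
... | x , xs , runs≡ = suc x , xs , runs-true bs runs≡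

prodCatA-runs : ∀ {n} r (K : Subset n) {x xs} → runs (toList K) ≡ x ∷ xs →
  prodₚ (map CatA (r ℕ.+ x ∷ xs)) ≈ₚ catRuns r K
prodCatA-runs r [] refl rewrite ℕₚ.+-identityʳ r = P.*-identityʳ (CatA r)
prodCatA-runs r (false ∷ K) refl with runs-nonempty (toList K)
... | x , xs , runs≡ rewrite ℕₚ.+-identityʳ r | runs≡ = P.*-congˡ {CatA r} (prodCatA-runs 0 K runs≡)
prodCatA-runs r (true ∷ K) runs≡ with runs-nonempty (toList K)
... | x , xs , runsK≡ with trans (sym runs≡) (runs-true (toList K) runsK≡)
... | refl rewrite ℕₚ.+-suc r x = prodCatA-runs (suc r) K runsK≡

CatPar≈catRuns : ∀ {n} (K : Subset n) → CatPar K ≈ₚ catRuns 0 K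
CatPar≈catRuns K with runs-nonempty (toList K)
... | x , xs , runs≡ rewrite runs≡ = prodCatA-runs 0 K runs≡

catPlusPlusRuns : ℕ → ℕ → Poly
catPlusPlusRuns r n = subsetSum t n (catRuns r)

+t*-congˡ : ∀ c {a b} → a ≈ₚ b → c +ₚ t *ₚ a ≈ₚ c +ₚ t *ₚ b
+t*-congˡ c a≈b = P.+-congˡ {c} (P.*-congˡ {t} a≈b)

catPlusPlusRuns-suc : ∀ r n →
  catPlusPlusRuns r (suc n) ≈ₚ t *ₚ (CatA r *ₚ catPlusPlusRuns 0 n) +ₚ catPlusPlusRuns (suc r) n
catPlusPlusRuns-suc r n =
  P.+-congʳ {catPlusPlusRuns (suc r) n} (P.*-congˡ {t} (subsetSum-*ˡ t n (CatA r) (catRuns 0)))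

catPlusPlusRuns-unfold : ∀ r m →
  catPlusPlusRuns r (suc m) ≈ₚ
    CatA (r ℕ.+ suc m) +ₚ t *ₚ sum≤ (λ i → CatA (r ℕ.+ i) *ₚ catPlusPlusRuns 0 (m ∸ i)) m
catPlusPlusRuns-unfold r zero = begin
  catPlusPlusRuns r 1                                ≈⟨ catPlusPlusRuns-suc r 0 ⟩
  t *ₚ (CatA r *ₚ CatA 0) +ₚ CatA (suc r)            ≈⟨ P.+-comm (t *ₚ (CatA r *ₚ CatA 0)) (CatA (suc r)) ⟩
  CatA (suc r) +ₚ t *ₚ (CatA r *ₚ CatA 0)
    ≡⟨ cong₂ (λ a b → CatA a +ₚ t *ₚ (CatA b *ₚ CatA 0)) (ℕₚ.+-comm 1 r) (sym (ℕₚ.+-identityʳ r)) ⟩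
  CatA (r ℕ.+ 1) +ₚ t *ₚ (CatA (r ℕ.+ 0) *ₚ CatA 0)  ∎
  where open import Relation.Binary.Reasoning.Setoid P.setoid
catPlusPlusRuns-unfold r (suc m) = begin
  catPlusPlusRuns r (2 ℕ.+ m)
    ≈⟨ catPlusPlusRuns-suc r (suc m) ⟩
  t *ₚ (CatA r *ₚ G (suc m)) +ₚ catPlusPlusRuns (suc r) (suc m)
    ≈⟨ P.+-congˡ {t *ₚ (CatA r *ₚ G (suc m))} (catPlusPlusRuns-unfold (suc r) m) ⟩
  t *ₚ (CatA r *ₚ G (suc m)) +ₚ (CatA (suc r ℕ.+ suc m) +ₚ t *ₚ rest)
    ≈⟨ regroup t (CatA r *ₚ G (suc m)) (CatA (suc r ℕ.+ suc m)) rest ⟩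
  CatA (suc r ℕ.+ suc m) +ₚ t *ₚ (CatA r *ₚ G (suc m) +ₚ rest)
    ≡⟨ cong₂ (λ a b → CatA a +ₚ t *ₚ (CatA b *ₚ G (suc m) +ₚ rest))
             (sym (ℕₚ.+-suc r (suc m))) (sym (ℕₚ.+-identityʳ r)) ⟩
  CatA (r ℕ.+ suc (suc m)) +ₚ t *ₚ (CatA (r ℕ.+ 0) *ₚ G (suc m) +ₚ rest)
    ≈⟨ +t*-congˡ (CatA (r ℕ.+ suc (suc m))) (P.+-congˡ {CatA (r ℕ.+ 0) *ₚ G (suc m)} shift-index) ⟨
  CatA (r ℕ.+ suc (suc m)) +ₚ t *ₚ (CatA (r ℕ.+ 0) *ₚ G (suc m) +ₚ sum≤ (λ i → term (suc i)) m)
    ≈⟨ +t*-congˡ (CatA (r ℕ.+ suc (suc m))) (sum≤-suc term m) ⟨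
  CatA (r ℕ.+ suc (suc m)) +ₚ t *ₚ sum≤ term (suc m) ∎
  where
  open import Relation.Binary.Reasoning.Setoid P.setoid
  G : ℕ → Poly
  G = catPlusPlusRuns 0
  term : ℕ → Poly
  term i = CatA (r ℕ.+ i) *ₚ G (suc m ∸ i)
  rest : Poly
  rest = sum≤ (λ i → CatA (suc r ℕ.+ i) *ₚ G (m ∸ i)) m
  shift-index : sum≤ (λ i → term (suc i)) m ≈ₚ rest
  shift-index = sum≤-cong m (λ i → P.reflexive (cong (λ a → CatA a *ₚ G (m ∸ i)) (ℕₚ.+-suc r i)))
  regroup : ∀ t a c s → t *ₚ a +ₚ (c +ₚ t *ₚ s) ≈ₚ c +ₚ t *ₚ (a +ₚ s)
  regroup = solve 4 (λ t a c s → t :* a :+ (c :+ t :* s) := c :+ t :* (a :+ s)) P.refl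
    where open Poly-Solver

CatPlusPlusA≈catPlusPlusRuns : ∀ n → CatPlusPlusA n ≈ₚ catPlusPlusRuns 0 n
CatPlusPlusA≈catPlusPlusRuns n =
  P.trans (CatPlusPlusA≈subsetSum n) (subsetSum-cong n P.refl CatPar≈catRuns)

catPlusPlus-series : CatPlusPlusA ≋ CatA ⊕ const t ⊛ (X ⊛ (CatA ⊛ CatPlusPlusA))
catPlusPlus-series zero    = begin
  CatPlusPlusA 0                                ≈⟨ CatPlusPlusA≈catPlusPlusRuns 0 ⟩
  CatA 0                                        ≈⟨ P.+-identityʳ (CatA 0) ⟨
  CatA 0 +ₚ 0ₚ                                  ≈⟨ P.+-congˡ {CatA 0} (P.zeroʳ t) ⟨
  CatA 0 +ₚ t *ₚ 0ₚ                             ≈⟨ +t*-congˡ (CatA 0) (X⊛-zero (CatA ⊛ CatPlusPlusA)) ⟨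
  CatA 0 +ₚ t *ₚ (X ⊛ (CatA ⊛ CatPlusPlusA)) 0  ∎
  where open import Relation.Binary.Reasoning.Setoid P.setoid
catPlusPlus-series (suc m) = begin
  CatPlusPlusA (suc m)
    ≈⟨ CatPlusPlusA≈catPlusPlusRuns (suc m) ⟩
  catPlusPlusRuns 0 (suc m)
    ≈⟨ catPlusPlusRuns-unfold 0 m ⟩
  CatA (suc m) +ₚ t *ₚ sum≤ (λ i → CatA i *ₚ catPlusPlusRuns 0 (m ∸ i)) m
    ≈⟨ +t*-congˡ (CatA (suc m)) (sum≤-cong m (λ i →
         P.*-congˡ {CatA i} (P.sym (CatPlusPlusA≈catPlusPlusRuns (m ∸ i))))) ⟩
  CatA (suc m) +ₚ t *ₚ (CatA ⊛ CatPlusPlusA) m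
    ≈⟨ +t*-congˡ (CatA (suc m)) (X⊛-suc (CatA ⊛ CatPlusPlusA) m) ⟨
  CatA (suc m) +ₚ t *ₚ (X ⊛ (CatA ⊛ CatPlusPlusA)) (suc m)
    ≈⟨ P.+-congˡ {CatA (suc m)} (const-⊛ t (X ⊛ (CatA ⊛ CatPlusPlusA)) (suc m)) ⟨
  (CatA ⊕ const t ⊛ (X ⊛ (CatA ⊛ CatPlusPlusA))) (suc m) ∎
  where open import Relation.Binary.Reasoning.Setoid P.setoid

-- Modulo the functional equations of G and N (decompose), the difference D of the two sides
-- satisfies D = -(1+q) x N D, which forces D = 0.
proposition4p43-series : [1+q] ⊛ CatPlusPlusA ⊕ [q] ⊛ (X ⊛ CatPlusPlusA) ≋ [1+q] ⊕ [q] ⊛ (X ⊛ CatA)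
proposition4p43-series = x∙y⁻¹≈ε⇒x≈y _ _ (fixedPoint-X⊛-unique (⊝ [1+q] ⊛ CatA) D≋X⊛[-[1+q]N⊛D])
  where
  open import Algebra.Properties.Group S.+-group using (x∙y⁻¹≈ε⇒x≈y; x≈y⇒x∙y⁻¹≈ε)
  open import Relation.Binary.Reasoning.Setoid S.setoid
  -- The solver reads the integer 1 as `one`, which is 𝟙 only up to ≋.
  one : Series
  one = const (ℤ[[q]].const (+ 1))
  N-equation : CatA S.- (one ⊕ [1+q] ⊛ (X ⊛ CatA) ⊕ [q] ⊛ ((X ⊛ CatA) ⊛ (X ⊛ CatA))) ≋ 𝟘
  N-equation = x≈y⇒x∙y⁻¹≈ε (S.trans narayana-quadratic
    (S.+-congʳ {[q] ⊛ ((X ⊛ CatA) ⊛ (X ⊛ CatA))} (S.+-congʳ {[1+q] ⊛ (X ⊛ CatA)}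
      (S.sym (_-Raw-AlmostCommutative⟶_.1-homo (liftMorphism ℤ→Poly))))))
  G-equation : CatPlusPlusA S.- (CatA ⊕ ⊝ [1+q] ⊛ (X ⊛ (CatA ⊛ CatPlusPlusA))) ≋ 𝟘
  G-equation = x≈y⇒x∙y⁻¹≈ε (S.trans catPlusPlus-series
    (S.+-congˡ {CatA} (S.*-congʳ {X ⊛ (CatA ⊛ CatPlusPlusA)} (const-neg (1ₚ +ₚ qₚ)))))
  D : Series
  D = [1+q] ⊛ CatPlusPlusA ⊕ [q] ⊛ (X ⊛ CatPlusPlusA) S.- ([1+q] ⊕ [q] ⊛ (X ⊛ CatA))
  decompose : ∀ G N X c q →
    c ⊛ G ⊕ q ⊛ (X ⊛ G) S.- (c ⊕ q ⊛ (X ⊛ N)) ≋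
      (c ⊕ q ⊛ X) ⊛ (G S.- (N ⊕ ⊝ c ⊛ (X ⊛ (N ⊛ G))))
      ⊕ c ⊛ (N S.- (one ⊕ c ⊛ (X ⊛ N) ⊕ q ⊛ ((X ⊛ N) ⊛ (X ⊛ N))))
      ⊕ X ⊛ ((⊝ c ⊛ N) ⊛ (c ⊛ G ⊕ q ⊛ (X ⊛ G) S.- (c ⊕ q ⊛ (X ⊛ N))))
  decompose = solve 5 (λ G N X c q →
    c :* G :+ q :* (X :* G) :- (c :+ q :* (X :* N)) :=
      (c :+ q :* X) :* (G :- (N :+ :- c :* (X :* (N :* G))))
      :+ c :* (N :- (con (+ 1) :+ c :* (X :* N) :+ q :* ((X :* N) :* (X :* N))))
      :+ X :* ((:- c :* N) :* (c :* G :+ q :* (X :* G) :- (c :+ q :* (X :* N))))) S.refl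
    where open Poly[[x]]-Solver
  D≋X⊛[-[1+q]N⊛D] : D ≋ X ⊛ ((⊝ [1+q] ⊛ CatA) ⊛ D)
  D≋X⊛[-[1+q]N⊛D] = begin
    D
      ≈⟨ decompose CatPlusPlusA CatA X [1+q] [q] ⟩
    ([1+q] ⊕ [q] ⊛ X) ⊛ (CatPlusPlusA S.- (CatA ⊕ ⊝ [1+q] ⊛ (X ⊛ (CatA ⊛ CatPlusPlusA))))
      ⊕ [1+q] ⊛ (CatA S.- (one ⊕ [1+q] ⊛ (X ⊛ CatA) ⊕ [q] ⊛ ((X ⊛ CatA) ⊛ (X ⊛ CatA))))
      ⊕ X ⊛ ((⊝ [1+q] ⊛ CatA) ⊛ D)
      ≈⟨ S.+-congʳ {X ⊛ ((⊝ [1+q] ⊛ CatA) ⊛ D)}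
           (S.+-cong (S.*-congˡ {[1+q] ⊕ [q] ⊛ X} G-equation) (S.*-congˡ {[1+q]} N-equation)) ⟩
    ([1+q] ⊕ [q] ⊛ X) ⊛ 𝟘 ⊕ [1+q] ⊛ 𝟘 ⊕ X ⊛ ((⊝ [1+q] ⊛ CatA) ⊛ D)
      ≈⟨ S.+-congʳ {X ⊛ ((⊝ [1+q] ⊛ CatA) ⊛ D)}
           (S.trans (S.+-cong (S.zeroʳ ([1+q] ⊕ [q] ⊛ X)) (S.zeroʳ [1+q])) (S.+-identityʳ 𝟘)) ⟩
    𝟘 ⊕ X ⊛ ((⊝ [1+q] ⊛ CatA) ⊛ D)
      ≈⟨ S.+-identityˡ (X ⊛ ((⊝ [1+q] ⊛ CatA) ⊛ D)) ⟩
    X ⊛ ((⊝ [1+q] ⊛ CatA) ⊛ D) ∎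

proposition4p43 : (n : ℕ) → 1 ≤ n →
    (1ₚ +ₚ qₚ) *ₚ CatPlusPlusA n +ₚ qₚ *ₚ CatPlusPlusA (n ∸ 1)
    ≈ₚ qₚ *ₚ CatA (n ∸ 1)
proposition4p43 (suc n) _ = begin
  (1ₚ +ₚ qₚ) *ₚ CatPlusPlusA (suc n) +ₚ qₚ *ₚ CatPlusPlusA n
    ≈⟨ P.+-cong (const-⊛ (1ₚ +ₚ qₚ) CatPlusPlusA (suc n))
                (P.trans (const-⊛ qₚ (X ⊛ CatPlusPlusA) (suc n)) (P.*-congˡ {qₚ} (X⊛-suc CatPlusPlusA n))) ⟨
  ([1+q] ⊛ CatPlusPlusA ⊕ [q] ⊛ (X ⊛ CatPlusPlusA)) (suc n)   ≈⟨ proposition4p43-series (suc n) ⟩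
  0ₚ +ₚ ([q] ⊛ (X ⊛ CatA)) (suc n)                            ≈⟨ P.+-identityˡ _ ⟩
  ([q] ⊛ (X ⊛ CatA)) (suc n)                                  ≈⟨ const-⊛ qₚ (X ⊛ CatA) (suc n) ⟩
  qₚ *ₚ (X ⊛ CatA) (suc n)                                    ≈⟨ P.*-congˡ {qₚ} (X⊛-suc CatA n) ⟩
  qₚ *ₚ CatA n                                                ∎
  where open import Relation.Binary.Reasoning.Setoid P.setoid
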